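{- Let $\sigma$ be any subsequence (possibly empty) of $e\,w_l\,w_r\,c$. Neither $\mathbb{PM}^{sl}_\sigma$ nor $\mathbb{PM}^{\ell}_\sigma$ is the equivalent algebraic semantics of any Hilbert system (in the respective language $\langle\vee,*,\neg_r,\neg_l,0,1\rangle$, resp. $\langle\vee,\wedge,*,\neg_r,\neg_l,0,1\rangle$).
   Context: For a subsequence $\sigma$ of $e\,w_l\,w_r\,c$ ($a\le b$ means $a\vee b=b$): $\mathring{\mathbb{M}}^{sl}_\sigma$ is the class of algebras $\langle A,\vee,*,0,1\rangle$ with $\langle A,\vee\rangle$ a join-semilattice, $\langle A,*,1\rangle$ a monoid, $*$ distributing over $\vee$ on both sides, $0$ an arbitrary element, and satisfying, for each letter in $\sigma$: $e$: $x*y=y*x$; $w_l$: $x\le 1$; $w_r$: $0\le x$; $c$: $x\le x*x$. $\mathring{\mathbb{M}}^{\ell}_\sigma$ is the class of algebras $\langle A,\vee,\wedge,*,0,1\rangle$ whose $\langle\vee,\wedge\rangle$-reduct is a lattice and whose $\langle\vee,*,0,1\rangle$-reduct lies in $\mathring{\mathbb{M}}^{sl}_\sigma$. $\mathbb{PM}^{sl}_\sigma$ (resp. $\mathbb{PM}^{\ell}_\sigma$) is the class of algebras $\langle A,\vee,*,\neg_r,\neg_l,0,1\rangle$ (resp. $\langle A,\vee,\wedge,*,\neg_r,\neg_l,0,1\rangle$) with unary $\neg_r,\neg_l$ whose reduct without $\neg_r,\neg_l$ lies in $\mathring{\mathbb{M}}^{sl}_\sigma$ (resp. $\mathring{\mathbb{M}}^{\ell}_\sigma$)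 and such that for all $a,b$: $a*b\le 0$ iff $b\le\neg_r a$ iff $a\le\neg_l b$. A Hilbert system on a propositional language $\Psi$ is a substitution-invariant consequence relation $\vdash$ on $\Psi$-formulas. A class $\mathbb{K}$ of $\Psi$-algebras is the equivalent algebraic semantics of $\vdash$ (in the sense of Blok–Pigozzi) if there are translations $\tau$ from formulas to finite sets of $\Psi$-equations and $\rho$ from equations to finite sets of formulas, each given by a schema in variables, such that $\Gamma\vdash\varphi$ iff $\tau[\Gamma]\models_{\mathbb{K}}\tau(\varphi)$, and each equation $\varphi\approx\psi$ is $\models_{\mathbb{K}}$-interderivable with $\tau(\rho(\varphi\approx\psi))$; $E\models_{\mathbb{K}}\varepsilon$ means every assignment into a member of $\mathbb{K}$ satisfying $E$ satisfies $\varepsilon$. -}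

module Defs where

open import Data.Nat using (ℕ; zero; suc)
open import Data.Bool using (Bool; true; false)
open import Data.Unit using (⊤)
open import Data.Product using (Σ; ∃; _×_; _,_)
open import Data.List using (List)
open import Data.List.Membership.Propositional using (_∈_)
open import Relation.Binary.PropositionalEquality using (_≡_)
open import Relation.Nullary using (¬_)

-- The two languages: sl = ⟨∨,*,¬r,¬l,0,1⟩ and lat = ⟨∨,∧,*,¬r,¬l,0,1⟩

data Lang : Set where
  sl lat : Lang

data Fm : Lang → Set where
  var  : ∀ {L} → ℕ → Fm L
  _∨ᶠ_ : ∀ {L} → Fm L → Fm L → Fm L
  _*ᶠ_ : ∀ {L} → Fm L → Fm L → Fm L
  _∧ᶠ_ : Fm lat → Fm lat → Fm lat
  ¬rᶠ  : ∀ {L} → Fm L → Fm L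
  ¬lᶠ  : ∀ {L} → Fm L → Fm L
  0ᶠ   : ∀ {L} → Fm L
  1ᶠ   : ∀ {L} → Fm L

subst : ∀ {L} → (ℕ → Fm L) → Fm L → Fm L
subst s (var n)   = s n
subst s (a ∨ᶠ b)  = subst s a ∨ᶠ subst s b
subst s (a *ᶠ b)  = subst s a *ᶠ subst s b
subst s (a ∧ᶠ b)  = subst s a ∧ᶠ subst s b
subst s (¬rᶠ a)   = ¬rᶠ (subst s a)
subst s (¬lᶠ a)   = ¬lᶠ (subst s a)
subst s 0ᶠ        = 0ᶠ
subst s 1ᶠ        = 1ᶠ

Eqn : Lang → Set
Eqn L = Fm L × Fm L

MeetOp : Lang → Set → Set
MeetOp sl  A = ⊤
MeetOp lat A = A → A → A

record Alg (L : Lang) : Set₁ where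
  field
    Carrier : Set
    _∨_  : Carrier → Carrier → Carrier
    _*_  : Carrier → Carrier → Carrier
    meet : MeetOp L Carrier
    ¬r   : Carrier → Carrier
    ¬l   : Carrier → Carrier
    𝟘    : Carrier
    𝟙    : Carrier

  _≤_ : Carrier → Carrier → Set
  a ≤ b = (a ∨ b) ≡ b

open Alg public

eval : ∀ {L} (A : Alg L) → (ℕ → Carrier A) → Fm L → Carrier A
eval A v (var n)  = v n
eval A v (a ∨ᶠ b) = _∨_ A (eval A v a) (eval A v b)
eval A v (a *ᶠ b) = _*_ A (eval A v a) (eval A v b)
eval A v (a ∧ᶠ b) = meet A (eval A v a) (eval A v b)
eval A v (¬rᶠ a)  = ¬r A (eval A v a)
eval A v (¬lᶠ a)  = ¬l A (eval A v a)
eval A v 0ᶠ       = 𝟘 A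
eval A v 1ᶠ       = 𝟙 A

Sat : ∀ {L} (A : Alg L) → (ℕ → Carrier A) → Eqn L → Set
Sat A v (s , t) = eval A v s ≡ eval A v t

-- σ : a subsequence of e w_l w_r c, i.e. a choice of which letters occur

record Seq : Set where
  field
    e wl wr c : Bool

open Seq public

LatticeLaws : (L : Lang) → Alg L → Set
LatticeLaws sl  A = ⊤
LatticeLaws lat A =
  (∀ x y z → meet A (meet A x y) z ≡ meet A x (meet A y z)) ×
  (∀ x y → meet A x y ≡ meet A y x) ×
  (∀ x → meet A x x ≡ x) ×
  (∀ x y → _∨_ A x (meet A x y) ≡ x) ×
  (∀ x y → meet A x (_∨_ A x y) ≡ x)

record IsPM (σ : Seq) {L : Lang} (A : Alg L) : Set where
  open Alg A using () renaming (_≤_ to _≤A_)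
  private
    _⊔_ = _∨_ A
    _·_ = _*_ A
  field
    ∨-assoc : ∀ x y z → ((x ⊔ y) ⊔ z) ≡ (x ⊔ (y ⊔ z))
    ∨-comm  : ∀ x y → (x ⊔ y) ≡ (y ⊔ x)
    ∨-idem  : ∀ x → (x ⊔ x) ≡ x
    *-assoc : ∀ x y z → ((x · y) · z) ≡ (x · (y · z))
    *-identityˡ : ∀ x → (𝟙 A · x) ≡ x
    *-identityʳ : ∀ x → (x · 𝟙 A) ≡ x
    *-distribˡ-∨ : ∀ x y z → (x · (y ⊔ z)) ≡ ((x · y) ⊔ (x · z))
    *-distribʳ-∨ : ∀ x y z → ((y ⊔ z) · x) ≡ ((y · x) ⊔ (z · x))
    lattice : LatticeLaws L A
    ax-e  : e σ ≡ true → ∀ x y → (x · y) ≡ (y · x)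
    ax-wl : wl σ ≡ true → ∀ x → x ≤A 𝟙 A
    ax-wr : wr σ ≡ true → ∀ x → 𝟘 A ≤A x
    ax-c  : c σ ≡ true → ∀ x → x ≤A (x · x)
    res₁ : ∀ a b → (a · b) ≤A 𝟘 A → b ≤A ¬r A a
    res₂ : ∀ a b → b ≤A ¬r A a → (a · b) ≤A 𝟘 A
    res₃ : ∀ a b → b ≤A ¬r A a → a ≤A ¬l A b
    res₄ : ∀ a b → a ≤A ¬l A b → b ≤A ¬r A a

-- Hilbert systems = substitution-invariant consequence relations

Pred : Set → Set₁
Pred X = X → Set

_⊆_ : ∀ {X} → Pred X → Pred X → Set
P ⊆ Q = ∀ x → P x → Q x

image : ∀ {L} → (ℕ → Fm L) → Pred (Fm L) → Pred (Fm L)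
image s Γ ψ = ∃ λ χ → Γ χ × ψ ≡ subst s χ

record HilbertSystem (L : Lang) : Set₁ where
  field
    _⊢_ : Pred (Fm L) → Fm L → Set
    reflexive  : ∀ {Γ φ} → Γ φ → Γ ⊢ φ
    monotone   : ∀ {Γ Δ φ} → Γ ⊆ Δ → Γ ⊢ φ → Δ ⊢ φ
    cut        : ∀ {Γ Δ φ} → (∀ ψ → Δ ψ → Γ ⊢ ψ) → Δ ⊢ φ → Γ ⊢ φ
    structural : ∀ {Γ φ} (s : ℕ → Fm L) → Γ ⊢ φ → image s Γ ⊢ subst s φ

Class : Lang → Set₁
Class L = Alg L → Set

_⊨[_]_ : ∀ {L} → Pred (Eqn L) → Class L → Eqn L → Set₁
E ⊨[ K ] ε = ∀ A → K A → (v : ℕ → Carrier A) → (∀ d → E d → Sat A v d) → Sat A v ε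

-- Translations given by schemas
-- τ : one-variable schema, a finite list of equations δᵢ(x) ≈ εᵢ(x);
--     τ(φ) is obtained by substituting φ for the variable.
-- ρ : two-variable schema, a finite list of formulas Δⱼ(x,y);
--     ρ(φ≈ψ) is obtained by substituting φ for x (var 0) and ψ for y.

subst1 : ∀ {L} → Fm L → ℕ → Fm L
subst1 φ _ = φ

subst2 : ∀ {L} → Fm L → Fm L → ℕ → Fm L
subst2 φ ψ zero    = φ
subst2 φ ψ (suc _) = ψ

τ-app : ∀ {L} → List (Eqn L) → Fm L → Pred (Eqn L)
τ-app τ φ (s , t) = (∃ λ d → d ∈ τ × (s , t) ≡ (subst (subst1 φ) (Data.Product.proj₁ d) , subst (subst1 φ) (Data.Product.proj₂ d)))

ρ-app : ∀ {L} → List (Fm L) → Eqn L → Pred (Fm L)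
ρ-app ρ (φ , ψ) χ = ∃ λ δ → δ ∈ ρ × χ ≡ subst (subst2 φ ψ) δ

τ-set : ∀ {L} → List (Eqn L) → Pred (Fm L) → Pred (Eqn L)
τ-set τ Γ d = ∃ λ φ → Γ φ × τ-app τ φ d

_⊨*[_]_ : ∀ {L} → Pred (Eqn L) → Class L → Pred (Eqn L) → Set₁
E ⊨*[ K ] F = ∀ d → F d → E ⊨[ K ] d

singleton : ∀ {L} → Eqn L → Pred (Eqn L)
singleton d d' = d' ≡ d

IsEquivAlgSem : ∀ {L} → Class L → HilbertSystem L → Set₁
IsEquivAlgSem {L} K H =
  Σ (List (Eqn L)) λ τ → Σ (List (Fm L)) λ ρ →
    (∀ Γ φ → (Γ ⊢ φ → τ-set τ Γ ⊨*[ K ] τ-app τ φ)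
           × (τ-set τ Γ ⊨*[ K ] τ-app τ φ → Γ ⊢ φ))
    × (∀ φ ψ → (singleton (φ , ψ) ⊨*[ K ] τ-set τ (ρ-app ρ (φ , ψ)))
             × (τ-set τ (ρ-app ρ (φ , ψ)) ⊨[ K ] (φ , ψ)))
  where open HilbertSystem H

PM : (σ : Seq) (L : Lang) → Class L
PM σ L A = IsPM σ A

-- The three-element Gödel chain bot < mid < top (with * = ∧ and ¬x = x → bot) lies in every
-- PM_σ. The ternary relation "r = ¬¬p and q ∈ {p, r}" is compatible with its operations, so
-- every binary term δ has δ(mid,top) ∈ {δ(mid,mid), δ(top,top)}. The equations τ(ρ(x,y)) of
-- a would-be equivalence hold whenever x = y, hence also at (mid,top), yet they must force x = y.
module Submission where

open import Defs
open import Data.Nat using (ℕ; zero; suc)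
open import Data.Unit using (⊤; tt)
open import Data.Product using (∃-syntax; _×_; _,_; proj₁; proj₂)
open import Data.Sum using (_⊎_; inj₁; inj₂)
open import Data.List.Membership.Propositional using (_∈_)
open import Relation.Nullary using (¬_; Dec; yes; no)
open import Relation.Nullary.Decidable using (map′; from-yes; _×-dec_; _⊎-dec_; _→-dec_)
open import Relation.Binary.PropositionalEquality using (_≡_; _≢_; refl; cong; cong₂)
open Relation.Binary.PropositionalEquality.≡-Reasoning

eval-cong : ∀ {L} (A : Alg L) {v w : ℕ → Carrier A} → (∀ n → v n ≡ w n) →
            ∀ φ → eval A v φ ≡ eval A w φ
eval-cong A v≗w (var n)  = v≗w n
eval-cong A v≗w (φ ∨ᶠ ψ) = cong₂ (_∨_ A) (eval-cong A v≗w φ) (eval-cong A v≗w ψ)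
eval-cong A v≗w (φ *ᶠ ψ) = cong₂ (_*_ A) (eval-cong A v≗w φ) (eval-cong A v≗w ψ)
eval-cong A v≗w (φ ∧ᶠ ψ) = cong₂ (meet A) (eval-cong A v≗w φ) (eval-cong A v≗w ψ)
eval-cong A v≗w (¬rᶠ φ)  = cong (¬r A) (eval-cong A v≗w φ)
eval-cong A v≗w (¬lᶠ φ)  = cong (¬l A) (eval-cong A v≗w φ)
eval-cong A v≗w 0ᶠ       = refl
eval-cong A v≗w 1ᶠ       = refl

eval-subst : ∀ {L} (A : Alg L) (v : ℕ → Carrier A) (s : ℕ → Fm L) φ →
             eval A v (subst s φ) ≡ eval A (λ n → eval A v (s n)) φ
eval-subst A v s (var n)  = refl
eval-subst A v s (φ ∨ᶠ ψ) = cong₂ (_∨_ A) (eval-subst A v s φ) (eval-subst A v s ψ)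
eval-subst A v s (φ *ᶠ ψ) = cong₂ (_*_ A) (eval-subst A v s φ) (eval-subst A v s ψ)
eval-subst A v s (φ ∧ᶠ ψ) = cong₂ (meet A) (eval-subst A v s φ) (eval-subst A v s ψ)
eval-subst A v s (¬rᶠ φ)  = cong (¬r A) (eval-subst A v s φ)
eval-subst A v s (¬lᶠ φ)  = cong (¬l A) (eval-subst A v s φ)
eval-subst A v s 0ᶠ       = refl
eval-subst A v s 1ᶠ       = refl

assign₂ : {X : Set} → X → X → ℕ → X
assign₂ a b zero    = a
assign₂ a b (suc _) = b

eval-subst2 : ∀ {L} (A : Alg L) (v : ℕ → Carrier A) (φ ψ δ : Fm L) →
              eval A v (subst (subst2 φ ψ) δ) ≡ eval A (assign₂ (eval A v φ) (eval A v ψ)) δ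
eval-subst2 A v φ ψ δ = begin
  eval A v (subst (subst2 φ ψ) δ)                  ≡⟨ eval-subst A v (subst2 φ ψ) δ ⟩
  eval A (λ n → eval A v (subst2 φ ψ n)) δ          ≡⟨ eval-cong A pointwise δ ⟩
  eval A (assign₂ (eval A v φ) (eval A v ψ)) δ      ∎
  where
  pointwise : ∀ n → eval A v (subst2 φ ψ n) ≡ assign₂ (eval A v φ) (eval A v ψ) n
  pointwise zero    = refl
  pointwise (suc _) = refl

unary : ∀ {L} (A : Alg L) → Fm L → Carrier A → Carrier A
unary A s x = eval A (λ _ → x) s

eval-τρ-instance : ∀ {L} (A : Alg L) (v : ℕ → Carrier A) (φ ψ δ s : Fm L) →
                   eval A v (subst (subst1 (subst (subst2 φ ψ) δ)) s)
                     ≡ unary A s (eval A (assign₂ (eval A v φ) (eval A v ψ)) δ)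
eval-τρ-instance A v φ ψ δ s = begin
  eval A v (subst (subst1 (subst (subst2 φ ψ) δ)) s)     ≡⟨ eval-subst A v (subst1 _) s ⟩
  unary A s (eval A v (subst (subst2 φ ψ) δ))             ≡⟨ cong (unary A s) (eval-subst2 A v φ ψ δ) ⟩
  unary A s (eval A (assign₂ (eval A v φ) (eval A v ψ)) δ) ∎

BinaryTermsCollapse : ∀ {L} (A : Alg L) → Carrier A → Carrier A → Set
BinaryTermsCollapse A a b = ∀ δ → ∃[ c ] eval A (assign₂ a b) δ ≡ eval A (assign₂ c c) δ

¬equivAlgSem-of-collapse : ∀ {L} {K : Class L} {A : Alg L} → K A →
                           {a b : Carrier A} → a ≢ b → BinaryTermsCollapse A a b →
                           (H : HilbertSystem L) → ¬ IsEquivAlgSem K H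
¬equivAlgSem-of-collapse {A = A} A∈K {a} {b} a≢b collapse H (τ , ρ , _ , equiv) =
  a≢b (proj₂ (equiv (var 0) (var 1)) A A∈K (assign₂ a b) τρ-holds)
  where
  diagonal : ∀ {δ s t} → δ ∈ ρ → (s , t) ∈ τ → ∀ c →
             unary A s (eval A (assign₂ c c) δ) ≡ unary A t (eval A (assign₂ c c) δ)
  diagonal {δ} {s} {t} δ∈ρ st∈τ c = begin
    unary A s (eval A (assign₂ c c) δ)                  ≡˘⟨ eval-τρ-instance A (assign₂ c c) (var 0) (var 0) δ s ⟩
    eval A (assign₂ c c) (subst (subst1 φ) s)           ≡⟨ sat ⟩
    eval A (assign₂ c c) (subst (subst1 φ) t)           ≡⟨ eval-τρ-instance A (assign₂ c c) (var 0) (var 0) δ t ⟩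
    unary A t (eval A (assign₂ c c) δ)                  ∎
    where
    φ : Fm _
    φ = subst (subst2 (var 0) (var 0)) δ
    sat : Sat A (assign₂ c c) (subst (subst1 φ) s , subst (subst1 φ) t)
    sat = proj₁ (equiv (var 0) (var 0)) _ (φ , (δ , δ∈ρ , refl) , ((s , t) , st∈τ , refl))
                A A∈K (assign₂ c c) λ { _ refl → refl }

  τρ-holds : ∀ d → τ-set τ (ρ-app ρ (var 0 , var 1)) d → Sat A (assign₂ a b) d
  τρ-holds _ (_ , (δ , δ∈ρ , refl) , ((s , t) , st∈τ , refl)) with collapse δ
  ... | c , δab≡δcc = begin
    eval A (assign₂ a b) (subst (subst1 φ) s)   ≡⟨ eval-τρ-instance A (assign₂ a b) (var 0) (var 1) δ s ⟩
    unary A s (eval A (assign₂ a b) δ)          ≡⟨ cong (unary A s) δab≡δcc ⟩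
    unary A s (eval A (assign₂ c c) δ)          ≡⟨ diagonal δ∈ρ st∈τ c ⟩
    unary A t (eval A (assign₂ c c) δ)          ≡˘⟨ cong (unary A t) δab≡δcc ⟩
    unary A t (eval A (assign₂ a b) δ)          ≡˘⟨ eval-τρ-instance A (assign₂ a b) (var 0) (var 1) δ t ⟩
    eval A (assign₂ a b) (subst (subst1 φ) t)   ∎
    where
    φ : Fm _
    φ = subst (subst2 (var 0) (var 1)) δ

Rel₃ : Set → Set₁
Rel₃ X = X → X → X → Set

MeetClosed : (L : Lang) (A : Alg L) → Rel₃ (Carrier A) → Set
MeetClosed sl  A R = ⊤
MeetClosed lat A R = ∀ {x y z x′ y′ z′} → R x y z → R x′ y′ z′ →
                     R (meet A x x′) (meet A y y′) (meet A z z′)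

record Compatible {L} (A : Alg L) (R : Rel₃ (Carrier A)) : Set where
  field
    ∨-closed    : ∀ {x y z x′ y′ z′} → R x y z → R x′ y′ z′ →
                  R (_∨_ A x x′) (_∨_ A y y′) (_∨_ A z z′)
    *-closed    : ∀ {x y z x′ y′ z′} → R x y z → R x′ y′ z′ →
                  R (_*_ A x x′) (_*_ A y y′) (_*_ A z z′)
    meet-closed : MeetClosed L A R
    ¬r-closed   : ∀ {x y z} → R x y z → R (¬r A x) (¬r A y) (¬r A z)
    ¬l-closed   : ∀ {x y z} → R x y z → R (¬l A x) (¬l A y) (¬l A z)
    𝟘-closed    : R (𝟘 A) (𝟘 A) (𝟘 A)
    𝟙-closed    : R (𝟙 A) (𝟙 A) (𝟙 A)

eval-compatible : ∀ {L} {A : Alg L} {R : Rel₃ (Carrier A)} → Compatible A R →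
                  {u v w : ℕ → Carrier A} → (∀ n → R (u n) (v n) (w n)) →
                  ∀ φ → R (eval A u φ) (eval A v φ) (eval A w φ)
eval-compatible C gen (var n)  = gen n
eval-compatible C gen (φ ∨ᶠ ψ) = Compatible.∨-closed C (eval-compatible C gen φ) (eval-compatible C gen ψ)
eval-compatible C gen (φ *ᶠ ψ) = Compatible.*-closed C (eval-compatible C gen φ) (eval-compatible C gen ψ)
eval-compatible C gen (φ ∧ᶠ ψ) = Compatible.meet-closed C (eval-compatible C gen φ) (eval-compatible C gen ψ)
eval-compatible C gen (¬rᶠ φ)  = Compatible.¬r-closed C (eval-compatible C gen φ)
eval-compatible C gen (¬lᶠ φ)  = Compatible.¬l-closed C (eval-compatible C gen φ)
eval-compatible C gen 0ᶠ       = Compatible.𝟘-closed C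
eval-compatible C gen 1ᶠ       = Compatible.𝟙-closed C

data G₃ : Set where
  bot mid top : G₃

infixl 7 _⊓_
infixl 6 _⊔_
infix  4 _≟_ _≤?_

_⊔_ : G₃ → G₃ → G₃
bot ⊔ y   = y
top ⊔ y   = top
mid ⊔ top = top
mid ⊔ _   = mid

_⊓_ : G₃ → G₃ → G₃
bot ⊓ y   = bot
top ⊓ y   = y
mid ⊓ bot = bot
mid ⊓ _   = mid

¬₃ : G₃ → G₃
¬₃ bot = top
¬₃ _   = bot

_≟_ : (x y : G₃) → Dec (x ≡ y)
bot ≟ bot = yes refl
bot ≟ mid = no λ ()
bot ≟ top = no λ ()
mid ≟ bot = no λ ()
mid ≟ mid = yes refl
mid ≟ top = no λ ()
top ≟ bot = no λ ()
top ≟ mid = no λ ()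
top ≟ top = yes refl

_≤?_ : (x y : G₃) → Dec (x ⊔ y ≡ y)
x ≤? y = x ⊔ y ≟ y

∀? : {P : G₃ → Set} → (∀ x → Dec (P x)) → Dec (∀ x → P x)
∀? P? = map′ (λ (p , q , r) → λ { bot → p ; mid → q ; top → r })
             (λ h → h bot , h mid , h top)
             (P? bot ×-dec P? mid ×-dec P? top)

∀²? : {P : G₃ → G₃ → Set} → (∀ x y → Dec (P x y)) → Dec (∀ x y → P x y)
∀²? P? = ∀? λ x → ∀? (P? x)

∀³? : {P : G₃ → G₃ → G₃ → Set} → (∀ x y z → Dec (P x y z)) → Dec (∀ x y z → P x y z)
∀³? P? = ∀? λ x → ∀²? (P? x)

G₃-meet : (L : Lang) → MeetOp L G₃
G₃-meet sl  = tt
G₃-meet lat = _⊓_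

G₃-alg : (L : Lang) → Alg L
G₃-alg L = record { Carrier = G₃ ; _∨_ = _⊔_ ; _*_ = _⊓_ ; meet = G₃-meet L
                  ; ¬r = ¬₃ ; ¬l = ¬₃ ; 𝟘 = bot ; 𝟙 = top }

G₃-latticeLaws : (L : Lang) → LatticeLaws L (G₃-alg L)
G₃-latticeLaws sl  = tt
G₃-latticeLaws lat = from-yes (∀³? λ x y z → x ⊓ y ⊓ z ≟ x ⊓ (y ⊓ z))
                   , from-yes (∀²? λ x y → x ⊓ y ≟ y ⊓ x)
                   , from-yes (∀? λ x → x ⊓ x ≟ x)
                   , from-yes (∀²? λ x y → x ⊔ x ⊓ y ≟ x)
                   , from-yes (∀²? λ x y → x ⊓ (x ⊔ y) ≟ x)

G₃-isPM : (σ : Seq) (L : Lang) → IsPM σ (G₃-alg L)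
G₃-isPM σ L = record
  { ∨-assoc      = from-yes (∀³? λ x y z → x ⊔ y ⊔ z ≟ x ⊔ (y ⊔ z))
  ; ∨-comm       = from-yes (∀²? λ x y → x ⊔ y ≟ y ⊔ x)
  ; ∨-idem       = from-yes (∀? λ x → x ⊔ x ≟ x)
  ; *-assoc      = from-yes (∀³? λ x y z → x ⊓ y ⊓ z ≟ x ⊓ (y ⊓ z))
  ; *-identityˡ  = from-yes (∀? λ x → top ⊓ x ≟ x)
  ; *-identityʳ  = from-yes (∀? λ x → x ⊓ top ≟ x)
  ; *-distribˡ-∨ = from-yes (∀³? λ x y z → x ⊓ (y ⊔ z) ≟ x ⊓ y ⊔ x ⊓ z)
  ; *-distribʳ-∨ = from-yes (∀³? λ x y z → (y ⊔ z) ⊓ x ≟ y ⊓ x ⊔ z ⊓ x)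
  ; lattice      = G₃-latticeLaws L
  ; ax-e         = λ _ → from-yes (∀²? λ x y → x ⊓ y ≟ y ⊓ x)
  ; ax-wl        = λ _ → from-yes (∀? λ x → x ≤? top)
  ; ax-wr        = λ _ → from-yes (∀? λ x → bot ≤? x)
  ; ax-c         = λ _ → from-yes (∀? λ x → x ≤? x ⊓ x)
  ; res₁         = from-yes (∀²? λ a b → a ⊓ b ≤? bot →-dec b ≤? ¬₃ a)
  ; res₂         = from-yes (∀²? λ a b → b ≤? ¬₃ a →-dec a ⊓ b ≤? bot)
  ; res₃         = from-yes (∀²? λ a b → b ≤? ¬₃ a →-dec a ≤? ¬₃ b)
  ; res₄         = from-yes (∀²? λ a b → a ≤? ¬₃ b →-dec b ≤? ¬₃ a)
  }

-- Contains the triples (δ(mid,mid), δ(mid,top), δ(top,top)) of binary terms δ, because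
-- ¬¬ is an endomorphism of G₃ sending mid to top.
Flanked : Rel₃ G₃
Flanked p q r = r ≡ ¬₃ (¬₃ p) × (q ≡ p ⊎ q ≡ r)

flanked? : ∀ p q r → Dec (Flanked p q r)
flanked? p q r = r ≟ ¬₃ (¬₃ p) ×-dec (q ≟ p ⊎-dec q ≟ r)

Flanked-closed₂ : (G₃ → G₃ → G₃) → Set
Flanked-closed₂ _⊙_ = ∀ x y z x′ y′ z′ → Flanked x y z → Flanked x′ y′ z′ →
                      Flanked (x ⊙ x′) (y ⊙ y′) (z ⊙ z′)

⊔-flanked : Flanked-closed₂ _⊔_
⊔-flanked = from-yes (∀³? λ x y z → ∀³? λ x′ y′ z′ →
  flanked? x y z →-dec flanked? x′ y′ z′ →-dec flanked? (x ⊔ x′) (y ⊔ y′) (z ⊔ z′))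

⊓-flanked : Flanked-closed₂ _⊓_
⊓-flanked = from-yes (∀³? λ x y z → ∀³? λ x′ y′ z′ →
  flanked? x y z →-dec flanked? x′ y′ z′ →-dec flanked? (x ⊓ x′) (y ⊓ y′) (z ⊓ z′))

¬₃-flanked : ∀ x y z → Flanked x y z → Flanked (¬₃ x) (¬₃ y) (¬₃ z)
¬₃-flanked = from-yes (∀³? λ x y z → flanked? x y z →-dec flanked? (¬₃ x) (¬₃ y) (¬₃ z))

flanked-compatible : (L : Lang) → Compatible (G₃-alg L) Flanked
flanked-compatible L = record
  { ∨-closed    = ⊔-flanked _ _ _ _ _ _
  ; *-closed    = ⊓-flanked _ _ _ _ _ _
  ; meet-closed = meet-closed L
  ; ¬r-closed   = ¬₃-flanked _ _ _
  ; ¬l-closed   = ¬₃-flanked _ _ _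
  ; 𝟘-closed    = refl , inj₁ refl
  ; 𝟙-closed    = refl , inj₁ refl
  }
  where
  meet-closed : (L : Lang) → MeetClosed L (G₃-alg L) Flanked
  meet-closed sl  = tt
  meet-closed lat = ⊓-flanked _ _ _ _ _ _

flanked-generators : ∀ n → Flanked (assign₂ mid mid n) (assign₂ mid top n) (assign₂ top top n)
flanked-generators zero    = refl , inj₁ refl
flanked-generators (suc _) = refl , inj₂ refl

G₃-collapse : (L : Lang) → BinaryTermsCollapse (G₃-alg L) mid top
G₃-collapse L δ with proj₂ (eval-compatible (flanked-compatible L) flanked-generators δ)
... | inj₁ at-mid = mid , at-mid
... | inj₂ at-top = top , at-top

theorem28 : (σ : Seq) (L : Lang) (H : HilbertSystem L) → ¬ IsEquivAlgSem (PM σ L) H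
theorem28 σ L = ¬equivAlgSem-of-collapse (G₃-isPM σ L) (λ ()) (G₃-collapse L)
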